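{- Let $D$ be a strongly connected balanced bipartite digraph with partite sets of cardinalities $a$, where $a\geq 2$. Suppose that $d(x)+d(y)\geq 3a$ for every pair of distinct vertices $x,y$ of $D$ which have a common in-neighbour or a common out-neighbour. Then $D$ contains a cycle factor.
   Context: Digraphs are finite, with no loops and no multiple arcs. $d(v)=d^+(v)+d^-(v)$ is the total degree (outdegree plus indegree). A cycle factor is a collection of vertex-disjoint directed cycles whose vertex sets together cover $V(D)$. -}

module Defs where

open import Data.Nat using (ℕ; zero; suc; _+_; _≤_)
open import Data.Nat.ListAction using (sum)
open import Data.Bool using (Bool; true; false; if_then_else_)
open import Data.Fin using (Fin)
open import Data.List using (List; []; _∷_; _++_; length; take; map; concatMap; filter)
open import Data.List.Base using (allFin)
open import Data.List.Relation.Unary.Unique.Propositional using (Unique)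
open import Data.List.Relation.Unary.Linked using (Linked)
open import Data.List.Relation.Binary.Permutation.Propositional using (_↭_)
open import Data.Sum using (_⊎_)
import Data.Sum
import Data.Bool
open import Data.Product using (Σ; ∃; _×_; _,_)
open import Relation.Binary.PropositionalEquality using (_≡_; _≢_)
open import Relation.Binary.Construct.Closure.ReflexiveTransitive using (Star)

record Digraph (n : ℕ) : Set where
  field
    adj      : Fin n → Fin n → Bool
    loopless : ∀ v → adj v v ≡ false

module _ {n : ℕ} (D : Digraph n) where
  open Digraph D

  Arc : Fin n → Fin n → Set
  Arc u v = adj u v ≡ true

  indicator : Bool → ℕ
  indicator b = if b then 1 else 0

  outdeg : Fin n → ℕ
  outdeg v = sum (map (λ u → indicator (adj v u)) (allFin n))

  indeg : Fin n → ℕ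
  indeg v = sum (map (λ u → indicator (adj u v)) (allFin n))

  deg : Fin n → ℕ
  deg v = outdeg v + indeg v

  StronglyConnected : Set
  StronglyConnected = ∀ u v → Star Arc u v

  BalancedBipartite : ℕ → Set
  BalancedBipartite a =
    Σ (Fin n → Bool) λ side →
      (length (filter (λ v → side v Data.Bool.≟ true) (allFin n)) ≡ a) ×
      (length (filter (λ v → side v Data.Bool.≟ false) (allFin n)) ≡ a) ×
      (∀ u v → Arc u v → side u ≢ side v)

  CommonInOrOutNeighbour : Fin n → Fin n → Set
  CommonInOrOutNeighbour x y =
    (∃ λ z → Arc z x × Arc z y) Data.Sum.⊎ (∃ λ z → Arc x z × Arc y z)

  -- a directed cycle: a list of at least 2 distinct vertices v₀ … v_{k-1}
  -- with arcs vᵢ → vᵢ₊₁ and v_{k-1} → v₀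
  record Cycle : Set where
    field
      verts    : List (Fin n)
      len≥2    : 2 ≤ length verts
      distinct : Unique verts
      closed   : Linked Arc (verts ++ take 1 verts)

  -- cycle factor: vertex-disjoint cycles covering V(D), i.e. the
  -- concatenation of their vertex lists is a permutation of all vertices
  CycleFactor : Set
  CycleFactor = Σ (List Cycle) λ cs → concatMap Cycle.verts cs ↭ allFin n

module Submission where

-- Let A and B be the two sides. If some S ⊆ A had fewer than |S| out-neighbours T, pigeonhole would give two
-- vertices of S with a common out-neighbour, so 3a ≤ 2(|T| + a); dually, B ─ T is larger than A ─ S, and two of
-- its vertices have a common in-neighbour, which lies in A ─ S, so 3a ≤ 2(|A ─ S| + a). Adding the two gives
-- 2a ≤ 2|T| + 2|A ─ S| < 2|S| + 2|A ─ S| = 2a. So Hall's condition holds from A to B and, symmetrically, from B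
-- to A; the two perfect matchings together form a permutation σ with an arc v → σ v at every v, and the orbits
-- of σ are the cycles of a cycle factor. Strong connectivity only supplies an in- and an out-neighbour of every
-- vertex.

open import Defs
open import Data.Nat using (ℕ; _+_; _*_; _≤_)
open import Data.Fin using (Fin)
open import Relation.Binary.PropositionalEquality using (_≢_)

open import Data.Nat using (zero; suc; _∸_; _<_; _≤?_; _<?_; z≤n; s≤s; s≤s⁻¹)
import Data.Nat.Properties as ℕ
open import Data.Nat.Properties
  using (+-0-commutativeMonoid; ≤-refl; ≤-reflexive; ≤-trans; ≤-antisym; ≤-pred; <-irrefl; <⇒≱; ≰⇒>; ≮⇒≥;
         +-comm; +-suc; +-mono-≤; +-monoʳ-≤; +-mono-<; +-monoˡ-<; +-cancelʳ-≤; m≤m+n; m≤n+m;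
         m∸n+n≡m; m≤n⇒m<n∨m≡n; n≢0⇒n>0; <-cmp; ∸-monoʳ-<; n<1+n; m<n⇒m<1+n; suc-injective)
open import Data.Nat.GeneralisedArithmetic using (iterate)
open import Data.Nat.ListAction using (sum)
open import Data.Nat.Solver using (module +-*-Solver)
open +-*-Solver using (solve; _:+_; _:*_; _:=_; con)
open import Data.Bool using (Bool; true; false; if_then_else_; _∧_; _∨_; not)
import Data.Bool as Bool
import Data.Bool.Properties as Bool
open import Data.Bool.Properties using (not-involutive; not-injective; ¬-not)
open import Data.Fin using (zero; suc; toℕ)
import Data.Fin.Properties
open import Data.Fin.Properties using (_≟_; any?; all?; pigeonhole)
open import Data.Fin.Subset.Properties using (anySubset?)
open import Data.Vec using (lookup)
import Data.Vec as Vec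
open import Data.Vec.Properties using (lookup∘tabulate)
open import Data.List using (List; []; _∷_; _++_; [_]; length; map; filter; tabulate; concatMap; allFin)
import Data.List as List
open import Data.List.Properties using (map-tabulate; length-iterate; length-filter)
open import Data.List.Membership.Propositional using (_∈_; _∉_)
open import Data.List.Membership.Propositional.Properties using (∈-++⁺ˡ; ∈-++⁺ʳ; ∈-++⁻; ∈-filter⁺; ∈-filter⁻; ∈-allFin)
open import Data.List.Membership.Propositional.Properties.WithK using (unique∧set⇒bag)
open import Data.List.Relation.Unary.Any using (here; there)
import Data.List.Relation.Unary.All as All
open import Data.List.Relation.Unary.AllPairs using ([]; _∷_)
open import Data.List.Relation.Unary.Unique.Propositional using (Unique)
open import Data.List.Relation.Unary.Unique.Propositional.Properties using (++⁺; allFin⁺)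
open import Data.List.Relation.Unary.Linked using (Linked; [-]; _∷_)
open import Data.List.Relation.Binary.BagAndSetEquality using (∼bag⇒↭)
open import Data.Product using (∃; ∃₂; _×_; _,_; proj₁; proj₂)
open import Data.Sum using (_⊎_; inj₁; inj₂; [_,_]′)
open import Data.Empty using (⊥; ⊥-elim)
open import Function using (_∘_; id; flip)
open import Function.Bundles using (mk⇔)
open import Relation.Nullary using (¬_; Dec; yes; no; does; ¬?; _×-dec_; _→-dec_)
open import Relation.Nullary.Decidable using (dec-true)
open import Relation.Unary using (Decidable)
open import Relation.Binary.PropositionalEquality using (_≡_; refl; sym; trans; cong; cong₂; subst; subst₂; module ≡-Reasoning)
open import Relation.Binary.Definitions using (tri<; tri≈; tri>)
open import Relation.Binary.Construct.Closure.ReflexiveTransitive using (Star; ε; _◅_; reverse)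
open import Algebra.Properties.CommutativeMonoid.Sum +-0-commutativeMonoid
  using (sum-cong-≗; ∑-distrib-+; ∑-comm; sum-replicate-zero) renaming (sum to ∑)

variable
  n : ℕ
  P Q R : Fin n → Bool

does-true : ∀ {p} {A : Set p} (a? : Dec A) → does a? ≡ true → A
does-true (yes a) _ = a

∧-true⁻ : ∀ {a b} → a ∧ b ≡ true → a ≡ true × b ≡ true
∧-true⁻ {true} b≡true = refl , b≡true

∧-true⁺ : ∀ {a b} → a ≡ true → b ≡ true → a ∧ b ≡ true
∧-true⁺ refl refl = refl

true≢false : true ≢ false
true≢false ()

𝟙 : Bool → ℕ
𝟙 b = if b then 1 else 0

_⊆_ : (P Q : Fin n → Bool) → Set
P ⊆ Q = ∀ i → P i ≡ true → Q i ≡ true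

Disjoint : (P Q : Fin n → Bool) → Set
Disjoint P Q = ∀ i → P i ≡ true → Q i ≡ true → ⊥

_∪_ _∩_ _─_ : (P Q : Fin n → Bool) → Fin n → Bool
(P ∪ Q) i = P i ∨ Q i
(P ∩ Q) i = P i ∧ Q i
(P ─ Q) i = P i ∧ not (Q i)

⁅_⁆ : Fin n → Fin n → Bool
⁅ c ⁆ i = does (i ≟ c)

∑-mono-≤ : {f g : Fin n → ℕ} → (∀ i → f i ≤ g i) → ∑ f ≤ ∑ g
∑-mono-≤ {zero}  _   = z≤n
∑-mono-≤ {suc n} f≤g = +-mono-≤ (f≤g zero) (∑-mono-≤ (f≤g ∘ suc))

term≤∑ : (f : Fin n → ℕ) (i : Fin n) → f i ≤ ∑ f
term≤∑ f zero    = m≤m+n _ _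
term≤∑ f (suc i) = ≤-trans (term≤∑ (f ∘ suc) i) (m≤n+m _ _)

-- Opaque, so that unification solves card ?P = card P by ?P := P instead of unfolding the sum.
opaque
  card : (Fin n → Bool) → ℕ
  card P = ∑ (𝟙 ∘ P)

  card-cong : (∀ i → P i ≡ Q i) → card P ≡ card Q
  card-cong P≗Q = sum-cong-≗ (cong 𝟙 ∘ P≗Q)

  card-mono : P ⊆ Q → card P ≤ card Q
  card-mono {P = P} {Q = Q} P⊆Q = ∑-mono-≤ λ i → 𝟙-mono (P i) (Q i) (P⊆Q i)
    where
    𝟙-mono : ∀ a b → (a ≡ true → b ≡ true) → 𝟙 a ≤ 𝟙 b
    𝟙-mono false b _   = z≤n
    𝟙-mono true  b a⇒b with refl ← a⇒b refl = ≤-refl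

  card-empty : (∀ i → P i ≡ false) → card P ≡ 0
  card-empty {n} P≗false =
    trans (sum-cong-≗ (cong 𝟙 ∘ P≗false)) (sum-replicate-zero n)

  card-split : Q ⊆ P → card P ≡ card (P ─ Q) + card Q
  card-split {Q = Q} {P = P} Q⊆P =
    trans (sum-cong-≗ λ i → split (P i) (Q i) (Q⊆P i)) (∑-distrib-+ (𝟙 ∘ (P ─ Q)) (𝟙 ∘ Q))
    where
    split : ∀ p q → (q ≡ true → p ≡ true) → 𝟙 p ≡ 𝟙 (p ∧ not q) + 𝟙 q
    split false false _   = refl
    split false true  q⇒p with () ← q⇒p refl
    split true  false _   = refl
    split true  true  _   = refl

  ∈⇒1≤card : ∀ {x} → P x ≡ true → 1 ≤ card P
  ∈⇒1≤card {P = P} {x} Px = ≤-trans (≤-reflexive (cong 𝟙 (sym Px))) (term≤∑ (𝟙 ∘ P) x)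

  1≤card⇒∈ : 1 ≤ card P → ∃ λ x → P x ≡ true
  1≤card⇒∈ {suc n} {P} 1≤P with P zero in P₀
  ... | true  = zero , P₀
  ... | false with x , Px ← 1≤card⇒∈ {P = P ∘ suc} 1≤P = suc x , Px

  card≤1 : (∀ x y → P x ≡ true → P y ≡ true → x ≡ y) → card P ≤ 1
  card≤1 {zero}      _    = z≤n
  card≤1 {suc n} {P} uniq with P zero in P₀
  ... | true  = ≤-reflexive (cong suc (card-empty {P = P ∘ suc} rest))
    where
    rest : ∀ i → P (suc i) ≡ false
    rest i with P (suc i) in Pᵢ
    ... | true with () ← uniq zero (suc i) P₀ Pᵢ
    ... | false = refl
  ... | false = card≤1 {P = P ∘ suc} λ x y Px Py → Data.Fin.Properties.suc-injective (uniq _ _ Px Py)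

  card-⁅⁆ : (c : Fin n) → card ⁅ c ⁆ ≡ 1
  card-⁅⁆ c = ≤-antisym
    (card≤1 {P = ⁅ c ⁆} λ x y x≡c y≡c → trans (does-true (x ≟ c) x≡c) (sym (does-true (y ≟ c) y≡c)))
    (∈⇒1≤card {P = ⁅ c ⁆} {c} (dec-true (c ≟ c) refl))

  -- Double counting of the pairs (x , g x) with P x.
  card-injection : (g : Fin n → Fin n) → (∀ x → P x ≡ true → Q (g x) ≡ true) →
    (∀ x y → P x ≡ true → P y ≡ true → g x ≡ g y → x ≡ y) → card P ≤ card Q
  card-injection {n} {P} {Q} g into inj = begin
    card P                                  ≡⟨ sum-cong-≗ row ⟩
    ∑ (λ x → ∑ (λ y → 𝟙 (Hits x y)))        ≡⟨ ∑-comm (λ x y → 𝟙 (Hits x y)) ⟩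
    ∑ (λ y → ∑ (λ x → 𝟙 (Hits x y)))        ≤⟨ ∑-mono-≤ column ⟩
    card Q                                  ∎
    where
    open ℕ.≤-Reasoning
    Hits : Fin n → Fin n → Bool
    Hits x y = P x ∧ ⁅ g x ⁆ y
    row : ∀ x → 𝟙 (P x) ≡ ∑ (λ y → 𝟙 (P x ∧ ⁅ g x ⁆ y))
    row x with P x
    ... | true  = sym (card-⁅⁆ (g x))
    ... | false = sym (card-empty {n} {λ _ → false} λ _ → refl)
    column : ∀ y → ∑ (λ x → 𝟙 (Hits x y)) ≤ 𝟙 (Q y)
    column y with Q y in Qy
    ... | true  = card≤1 {P = λ x → Hits x y} λ x x′ hit hit′ →
      let Px , y≡gx = ∧-true⁻ hit; Px′ , y≡gx′ = ∧-true⁻ hit′ in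
      inj x x′ Px Px′ (trans (sym (does-true (y ≟ g x) y≡gx)) (does-true (y ≟ g x′) y≡gx′))
    ... | false = ≤-reflexive (card-empty {P = λ x → Hits x y} miss)
      where
      miss : ∀ x → P x ∧ does (y ≟ g x) ≡ false
      miss x with P x in Px | y ≟ g x
      ... | true  | yes refl with () ← trans (sym (into x Px)) Qy
      ... | true  | no _ = refl
      ... | false | _    = refl

  card-subadditive : (∀ i → P i ≡ true → Q i ≡ true ⊎ R i ≡ true) →
    card P ≤ card Q + card R
  card-subadditive {P = P} {Q} {R} cover =
    ≤-trans (∑-mono-≤ λ i → bound (P i) (Q i) (R i) (cover i)) (≤-reflexive (∑-distrib-+ (𝟙 ∘ Q) (𝟙 ∘ R)))
    where
    bound : ∀ p q r → (p ≡ true → q ≡ true ⊎ r ≡ true) → 𝟙 p ≤ 𝟙 q + 𝟙 r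
    bound false q     r     _ = z≤n
    bound true  true  r     _ = s≤s z≤n
    bound true  false true  _ = s≤s z≤n
    bound true  false false c with c refl
    ... | inj₁ ()
    ... | inj₂ ()

  card-∪ : Disjoint P Q → card (P ∪ Q) ≡ card P + card Q
  card-∪ {P = P} {Q} P∩Q=∅ =
    trans (sum-cong-≗ λ i → split (P i) (Q i) (P∩Q=∅ i)) (∑-distrib-+ (𝟙 ∘ P) (𝟙 ∘ Q))
    where
    split : ∀ p q → (p ≡ true → q ≡ true → ⊥) → 𝟙 (p ∨ q) ≡ 𝟙 p + 𝟙 q
    split false q     _ = refl
    split true  false _ = refl
    split true  true  disjoint with () ← disjoint refl refl

  card≡sum-allFin : card P ≡ sum (map (𝟙 ∘ P) (allFin n))
  card≡sum-allFin {P = P} = trans (∑≡sum-tabulate (𝟙 ∘ P)) (cong sum (sym (map-tabulate id (𝟙 ∘ P))))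
    where
    ∑≡sum-tabulate : ∀ {n} (f : Fin n → ℕ) → ∑ f ≡ sum (tabulate f)
    ∑≡sum-tabulate {zero}  f = refl
    ∑≡sum-tabulate {suc n} f = cong (f zero +_) (∑≡sum-tabulate (f ∘ suc))

length-filter≡card : ∀ {p} {A : Fin n → Set p} (A? : Decidable A) → length (filter A? (allFin n)) ≡ card (does ∘ A?)
length-filter≡card {n} A? = trans (count (allFin n)) (sym card≡sum-allFin)
  where
  count : ∀ xs → length (filter A? xs) ≡ sum (map (𝟙 ∘ does ∘ A?) xs)
  count []       = refl
  count (x ∷ xs) with A? x
  ... | yes _ = cong suc (count xs)
  ... | no  _ = count xs

length-filter-true : (s : Fin n → Bool) → length (filter (λ v → s v Bool.≟ true) (allFin n)) ≡ card s
length-filter-true s = trans (length-filter≡card _) (card-cong λ v → does-≟-true (s v))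
  where
  does-≟-true : ∀ b → does (b Bool.≟ true) ≡ b
  does-≟-true true  = refl
  does-≟-true false = refl

length-filter-false : (s : Fin n → Bool) → length (filter (λ v → s v Bool.≟ false) (allFin n)) ≡ card (not ∘ s)
length-filter-false s = trans (length-filter≡card _) (card-cong λ v → does-≟-false (s v))
  where
  does-≟-false : ∀ b → does (b Bool.≟ false) ≡ not b
  does-≟-false true  = refl
  does-≟-false false = refl

collision : (g : Fin n → Fin n) → card Q < card P → (∀ x → P x ≡ true → Q (g x) ≡ true) →
  ∃₂ λ x y → x ≢ y × P x ≡ true × P y ≡ true × g x ≡ g y
collision {P = P} g Q<P into with any? (λ x → any? (λ y → collides? x y))
  where
  collides? : ∀ x y → Dec (x ≢ y × P x ≡ true × P y ≡ true × g x ≡ g y)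
  collides? x y = ¬? (x ≟ y) ×-dec P x Bool.≟ true ×-dec P y Bool.≟ true ×-dec g x ≟ g y
... | yes (x , y , c) = x , y , c
... | no none = ⊥-elim (<⇒≱ Q<P (card-injection g into injective))
  where
  injective : ∀ x y → P x ≡ true → P y ≡ true → g x ≡ g y → x ≡ y
  injective x y Px Py gx≡gy with x ≟ y
  ... | yes x≡y = x≡y
  ... | no  x≢y = ⊥-elim (none (x , y , x≢y , Px , Py , gx≡gy))

∩-⊆ʳ : (P ∩ Q) ⊆ Q
∩-⊆ʳ i = proj₂ ∘ ∧-true⁻

─-⊆ : (P ─ Q) ⊆ P
─-⊆ i = proj₁ ∘ ∧-true⁻

─-disjoint : Disjoint Q (P ─ Q)
─-disjoint i Qi P─Qi with () ← trans (sym (proj₂ (∧-true⁻ P─Qi))) (cong not Qi)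

⁅⁆-⊆ : ∀ {x} → P x ≡ true → ⁅ x ⁆ ⊆ P
⁅⁆-⊆ {P = P} {x} Px i i≡x = subst (λ j → P j ≡ true) (sym (does-true (i ≟ x) i≡x)) Px

card-─⁅⁆ : ∀ {x} → P x ≡ true → card P ≡ suc (card (P ─ ⁅ x ⁆))
card-─⁅⁆ {P = P} {x} Px = begin
  card P                         ≡⟨ card-split (⁅⁆-⊆ {P = P} Px) ⟩
  card (P ─ ⁅ x ⁆) + card ⁅ x ⁆  ≡⟨ cong (card (P ─ ⁅ x ⁆) +_) (card-⁅⁆ x) ⟩
  card (P ─ ⁅ x ⁆) + 1           ≡⟨ +-comm _ 1 ⟩
  suc (card (P ─ ⁅ x ⁆))         ∎
  where open ≡-Reasoning

module Hall {n : ℕ} (E : Fin n → Fin n → Bool) where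

  opaque
    Γ : (R S : Fin n → Bool) → Fin n → Bool
    Γ R S y = R y ∧ does (any? λ x → S x ∧ E x y Bool.≟ true)

    Γ⁺ : ∀ {R S x y} → R y ≡ true → S x ≡ true → E x y ≡ true → Γ R S y ≡ true
    Γ⁺ {S = S} {y = y} Ry Sx Exy =
      ∧-true⁺ Ry (dec-true (any? λ x → S x ∧ E x y Bool.≟ true) (_ , ∧-true⁺ Sx Exy))

    Γ⁻ : ∀ {R S y} → Γ R S y ≡ true → R y ≡ true × ∃ λ x → S x ≡ true × E x y ≡ true
    Γ⁻ {S = S} {y} Γy with Ry , found ← ∧-true⁻ Γy
      with x , SEx ← does-true (any? λ x → S x ∧ E x y Bool.≟ true) found = Ry , x , ∧-true⁻ SEx

  Γ-monoʳ : ∀ {R S S′} → S ⊆ S′ → Γ R S ⊆ Γ R S′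
  Γ-monoʳ S⊆S′ y ΓSy with Ry , x , Sx , Exy ← Γ⁻ ΓSy = Γ⁺ Ry (S⊆S′ x Sx) Exy

  HallCondition : (L R : Fin n → Bool) → Set
  HallCondition L R = ∀ S → S ⊆ L → card S ≤ card (Γ R S)

  Expanding : (L R : Fin n → Bool) → Set
  Expanding L R = ∀ S → S ⊆ L → 1 ≤ card S → card S < card L → card S < card (Γ R S)

  record Matching (L R : Fin n → Bool) : Set where
    field
      match     : Fin n → Fin n
      lands     : ∀ x → L x ≡ true → R (match x) ≡ true
      along     : ∀ x → L x ≡ true → E x (match x) ≡ true
      injective : ∀ x y → L x ≡ true → L y ≡ true → match x ≡ match y → x ≡ y

  open Matching

  Matching-⊆ : ∀ {L L′ R R′} → L′ ⊆ L → R ⊆ R′ → Matching L R → Matching L′ R′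
  Matching-⊆ L′⊆L R⊆R′ m = record
    { match     = match m
    ; lands     = λ x L′x → R⊆R′ _ (lands m x (L′⊆L x L′x))
    ; along     = λ x L′x → along m x (L′⊆L x L′x)
    ; injective = λ x y L′x L′y → injective m x y (L′⊆L x L′x) (L′⊆L y L′y)
    }

  Matching-empty : ∀ {L R} → (∀ x → L x ≡ true → ⊥) → Matching L R
  Matching-empty L-empty = record
    { match     = λ x → x
    ; lands     = λ x Lx → ⊥-elim (L-empty x Lx)
    ; along     = λ x Lx → ⊥-elim (L-empty x Lx)
    ; injective = λ x y Lx _ _ → ⊥-elim (L-empty x Lx)
    }

  Matching-⁅⁆ : ∀ {x₀ y₀} → E x₀ y₀ ≡ true → Matching ⁅ x₀ ⁆ ⁅ y₀ ⁆
  Matching-⁅⁆ {x₀} {y₀} Ex₀y₀ = record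
    { match     = λ _ → y₀
    ; lands     = λ _ _ → dec-true (y₀ ≟ y₀) refl
    ; along     = λ x x≡x₀ → subst (λ z → E z y₀ ≡ true) (sym (does-true (x ≟ x₀) x≡x₀)) Ex₀y₀
    ; injective = λ x y x≡x₀ y≡x₀ _ → trans (does-true (x ≟ x₀) x≡x₀) (sym (does-true (y ≟ x₀) y≡x₀))
    }

  Matching-glue : ∀ {L R R₁ R₂} (S : Fin n → Bool) → Matching (L ∩ S) R₁ → Matching (L ─ S) R₂ →
    R₁ ⊆ R → R₂ ⊆ R → Disjoint R₁ R₂ → Matching L R
  Matching-glue {L} {R₁ = R₁} {R₂} S m₁ m₂ R₁⊆R R₂⊆R R₁∩R₂=∅ = record
    { match     = glued
    ; lands     = λ x Lx → [ (λ (x₁ , gx) → R₁⊆R _ (subst (λ z → R₁ z ≡ true) (sym gx) (lands m₁ x x₁)))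
                           , (λ (x₂ , gx) → R₂⊆R _ (subst (λ z → R₂ z ≡ true) (sym gx) (lands m₂ x x₂))) ]′ (piece x Lx)
    ; along     = λ x Lx → [ (λ (x₁ , gx) → subst (λ z → E x z ≡ true) (sym gx) (along m₁ x x₁))
                           , (λ (x₂ , gx) → subst (λ z → E x z ≡ true) (sym gx) (along m₂ x x₂)) ]′ (piece x Lx)
    ; injective = glued-injective
    }
    where
    glued : Fin n → Fin n
    glued x = if S x then match m₁ x else match m₂ x

    piece : ∀ x → L x ≡ true →
      (L x ∧ S x ≡ true × glued x ≡ match m₁ x) ⊎ (L x ∧ not (S x) ≡ true × glued x ≡ match m₂ x)
    piece x Lx with S x
    ... | true  = inj₁ (∧-true⁺ Lx refl , refl)
    ... | false = inj₂ (∧-true⁺ Lx refl , refl)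

    clash : ∀ {x y} → (L ∩ S) x ≡ true → (L ─ S) y ≡ true → match m₁ x ≡ match m₂ y → ⊥
    clash {x} {y} x₁ y₂ eq =
      R₁∩R₂=∅ _ (lands m₁ x x₁) (subst (λ z → R₂ z ≡ true) (sym eq) (lands m₂ y y₂))

    glued-injective : ∀ x y → L x ≡ true → L y ≡ true → glued x ≡ glued y → x ≡ y
    glued-injective x y Lx Ly eq with piece x Lx | piece y Ly
    ... | inj₁ (x₁ , gx) | inj₁ (y₁ , gy) = injective m₁ x y x₁ y₁ (trans (sym gx) (trans eq gy))
    ... | inj₂ (x₂ , gx) | inj₂ (y₂ , gy) = injective m₂ x y x₂ y₂ (trans (sym gx) (trans eq gy))
    ... | inj₁ (x₁ , gx) | inj₂ (y₂ , gy) = ⊥-elim (clash x₁ y₂ (trans (sym gx) (trans eq gy)))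
    ... | inj₂ (x₂ , gx) | inj₁ (y₁ , gy) = ⊥-elim (clash y₁ x₂ (trans (sym gy) (trans (sym eq) gx)))

  hall-inside : ∀ {L R S} → S ⊆ L → HallCondition L R → HallCondition S (Γ R S)
  hall-inside {L} {R} {S} S⊆L hall S′ S′⊆S =
    ≤-trans (hall S′ (λ x → S⊆L x ∘ S′⊆S x)) (card-mono ΓS′⊆)
    where
    ΓS′⊆ : Γ R S′ ⊆ Γ (Γ R S) S′
    ΓS′⊆ y ΓS′y with Ry , x , S′x , Exy ← Γ⁻ ΓS′y = Γ⁺ (Γ⁺ Ry (S′⊆S x S′x) Exy) S′x Exy

  hall-outside : ∀ {L R S} → S ⊆ L → card (Γ R S) ≤ card S → HallCondition L R →
    HallCondition (L ─ S) (R ─ Γ R S)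
  hall-outside {L} {R} {S} S⊆L ΓS≤S hall S′ S′⊆L─S = +-cancelʳ-≤ (card S) _ _ (begin
    card S′ + card S                       ≡⟨ card-∪ S′∩S=∅ ⟨
    card (S′ ∪ S)                          ≤⟨ hall (S′ ∪ S) S′∪S⊆L ⟩
    card (Γ R (S′ ∪ S))                    ≤⟨ card-subadditive cover ⟩
    card (Γ (R ─ Γ R S) S′) + card (Γ R S) ≤⟨ +-monoʳ-≤ _ ΓS≤S ⟩
    card (Γ (R ─ Γ R S) S′) + card S       ∎)
    where
    open ℕ.≤-Reasoning
    S′∩S=∅ : Disjoint S′ S
    S′∩S=∅ x S′x Sx with () ← trans (sym (proj₂ (∧-true⁻ (S′⊆L─S x S′x)))) (cong not Sx)
    S′∪S⊆L : (S′ ∪ S) ⊆ L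
    S′∪S⊆L x S′x∨Sx with S′ x in S′x | S x in Sx
    ... | true  | _    = proj₁ (∧-true⁻ (S′⊆L─S x S′x))
    ... | false | true = S⊆L x Sx
    cover : ∀ y → Γ R (S′ ∪ S) y ≡ true → Γ (R ─ Γ R S) S′ y ≡ true ⊎ Γ R S y ≡ true
    cover y ΓUy with Γ R S y in ΓSy
    ... | true  = inj₂ refl
    ... | false with Ry , x , Ux , Exy ← Γ⁻ ΓUy with S x in Sx
    ...   | true  with () ← trans (sym ΓSy) (Γ⁺ Ry Sx Exy)
    ...   | false = inj₁ (Γ⁺ (∧-true⁺ Ry (cong not ΓSy)) (trans (sym (Bool.∨-identityʳ _)) Ux) Exy)

  hall-delete-edge : ∀ {L R x₀ y₀} → Expanding L R → L x₀ ≡ true → HallCondition (L ─ ⁅ x₀ ⁆) (R ─ ⁅ y₀ ⁆)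
  hall-delete-edge {L} {R} {x₀} {y₀} expanding Lx₀ S S⊆L′ with card S ℕ.≟ 0
  ... | yes S≡0 = subst (_≤ card (Γ (R ─ ⁅ y₀ ⁆) S)) (sym S≡0) z≤n
  ... | no  S≢0 = ≤-pred (begin-strict
    card S                                 <⟨ expanding S S⊆L (n≢0⇒n>0 S≢0) S<L ⟩
    card (Γ R S)                           ≤⟨ card-subadditive cover ⟩
    card (Γ (R ─ ⁅ y₀ ⁆) S) + card ⁅ y₀ ⁆  ≡⟨ cong (card (Γ (R ─ ⁅ y₀ ⁆) S) +_) (card-⁅⁆ y₀) ⟩
    card (Γ (R ─ ⁅ y₀ ⁆) S) + 1            ≡⟨ +-comm _ 1 ⟩
    suc (card (Γ (R ─ ⁅ y₀ ⁆) S))          ∎)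
    where
    open ℕ.≤-Reasoning
    S⊆L : S ⊆ L
    S⊆L x = ─-⊆ {P = L} {Q = ⁅ x₀ ⁆} x ∘ S⊆L′ x
    S<L : card S < card L
    S<L = ≤-trans (s≤s (card-mono S⊆L′)) (≤-reflexive (sym (card-─⁅⁆ Lx₀)))
    cover : ∀ y → Γ R S y ≡ true → Γ (R ─ ⁅ y₀ ⁆) S y ≡ true ⊎ ⁅ y₀ ⁆ y ≡ true
    cover y ΓSy with ⁅ y₀ ⁆ y in y≟y₀
    ... | true  = inj₂ refl
    ... | false with Ry , x , Sx , Exy ← Γ⁻ ΓSy = inj₁ (Γ⁺ (∧-true⁺ Ry (cong not y≟y₀)) Sx Exy)

  Tight : (L R S : Fin n → Bool) → Set
  Tight L R S = S ⊆ L × 1 ≤ card S × card S < card L × card (Γ R S) ≤ card S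

  tight? : ∀ L R S → Dec (Tight L R S)
  tight? L R S = all? (λ i → (S i Bool.≟ true) →-dec (L i Bool.≟ true))
    ×-dec 1 ≤? card S ×-dec suc (card S) ≤? card L ×-dec card (Γ R S) ≤? card S

  Tight-≐ : ∀ {L R S S′} → S ⊆ S′ → S′ ⊆ S → Tight L R S → Tight L R S′
  Tight-≐ S⊆S′ S′⊆S (S⊆L , 1≤S , S<L , ΓS≤S) =
      (λ x → S⊆L x ∘ S′⊆S x)
    , ≤-trans 1≤S (card-mono S⊆S′)
    , ≤-trans (s≤s (card-mono S′⊆S)) S<L
    , ≤-trans (card-mono (Γ-monoʳ S′⊆S)) (≤-trans ΓS≤S (card-mono S⊆S′))

  module _ {k : ℕ} (induction : ∀ {L R} → card L ≤ k → HallCondition L R → Matching L R)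
           {L R : Fin n → Bool} (L≤1+k : card L ≤ suc k) (hall : HallCondition L R) where

    matching-tight : ∀ {S} → Tight L R S → Matching L R
    matching-tight {S} (S⊆L , 1≤S , S<L , ΓS≤S) =
      Matching-glue S inside outside (λ y → proj₁ ∘ Γ⁻) (─-⊆ {Q = Γ R S}) ─-disjoint
      where
      inside : Matching (L ∩ S) (Γ R S)
      inside = Matching-⊆ (∩-⊆ʳ {P = L}) (λ _ → id)
        (induction (≤-pred (≤-trans S<L L≤1+k)) (hall-inside S⊆L hall))
      L─S<L : card (L ─ S) < card L
      L─S<L = ≤-trans (≤-trans (≤-reflexive (+-comm 1 _)) (+-monoʳ-≤ (card (L ─ S)) 1≤S))
                      (≤-reflexive (sym (card-split S⊆L)))
      outside : Matching (L ─ S) (R ─ Γ R S)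
      outside = induction (≤-pred (≤-trans L─S<L L≤1+k)) (hall-outside S⊆L ΓS≤S hall)

    matching-expanding : ∀ {x₀} → L x₀ ≡ true → Expanding L R → Matching L R
    matching-expanding {x₀} Lx₀ expanding =
      Matching-glue ⁅ x₀ ⁆ edge rest (⁅⁆-⊆ Ry₀) (─-⊆ {Q = ⁅ y₀ ⁆}) ─-disjoint
      where
      x₀-has-neighbour : ∃ λ y → Γ R ⁅ x₀ ⁆ y ≡ true
      x₀-has-neighbour = 1≤card⇒∈ (≤-trans (≤-reflexive (sym (card-⁅⁆ x₀))) (hall ⁅ x₀ ⁆ (⁅⁆-⊆ Lx₀)))
      y₀ : Fin n
      y₀ = proj₁ x₀-has-neighbour
      Ry₀ : R y₀ ≡ true
      Ry₀ = proj₁ (Γ⁻ (proj₂ x₀-has-neighbour))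
      Ex₀y₀ : E x₀ y₀ ≡ true
      Ex₀y₀ with _ , x , x≡x₀ , Exy₀ ← Γ⁻ (proj₂ x₀-has-neighbour)
        with refl ← does-true (x ≟ x₀) x≡x₀ = Exy₀
      edge : Matching (L ∩ ⁅ x₀ ⁆) ⁅ y₀ ⁆
      edge = Matching-⊆ (∩-⊆ʳ {P = L}) (λ _ → id) (Matching-⁅⁆ Ex₀y₀)
      rest : Matching (L ─ ⁅ x₀ ⁆) (R ─ ⁅ y₀ ⁆)
      rest = induction (≤-pred (≤-trans (≤-reflexive (sym (card-─⁅⁆ Lx₀))) L≤1+k))
                       (hall-delete-edge expanding Lx₀)

  hall-theorem : ∀ k {L R} → card L ≤ k → HallCondition L R → Matching L R
  hall-theorem k {L} L≤k hall with any? (λ x → L x Bool.≟ true)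
  ... | no L=∅ = Matching-empty λ x Lx → L=∅ (x , Lx)
  hall-theorem zero    L≤0 hall | yes (x₀ , Lx₀) with () ← ≤-trans (∈⇒1≤card Lx₀) L≤0
  hall-theorem (suc k) {L} {R} L≤k hall | yes (x₀ , Lx₀)
    with anySubset? (tight? L R ∘ lookup)
  ... | yes (V , tight) = matching-tight (hall-theorem k) L≤k hall tight
  ... | no  no-tight    = matching-expanding (hall-theorem k) L≤k hall Lx₀ expanding
    where
    expanding : Expanding L R
    expanding S S⊆L 1≤S S<L with card S <? card (Γ R S)
    ... | yes S<ΓS = S<ΓS
    ... | no  S≮ΓS = ⊥-elim (no-tight (Vec.tabulate S , Tight-≐ S⊆V V⊆S (S⊆L , 1≤S , S<L , ≮⇒≥ S≮ΓS)))
      where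
      S⊆V : S ⊆ lookup (Vec.tabulate S)
      S⊆V i Si = trans (lookup∘tabulate S i) Si
      V⊆S : lookup (Vec.tabulate S) ⊆ S
      V⊆S i Vi = trans (sym (lookup∘tabulate S i)) Vi

least-witness : ∀ {P : ℕ → Set} → Decidable P → ∃ P → ∃ λ k → P k × (∀ j → j < k → ¬ P j)
least-witness {P} P? (m , Pm) with search (suc m)
  where
  search : ∀ m → (∃ λ k → P k × (∀ j → j < k → ¬ P j)) ⊎ (∀ j → j < m → ¬ P j)
  search zero = inj₂ λ _ ()
  search (suc m) with search m
  ... | inj₁ found = inj₁ found
  ... | inj₂ below with P? m
  ...   | yes Pm = inj₁ (m , Pm , below)
  ...   | no ¬Pm = inj₂ λ j j<1+m → [ below j , (λ { refl → ¬Pm }) ]′ (m≤n⇒m<n∨m≡n (s≤s⁻¹ j<1+m))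
... | inj₁ found = found
... | inj₂ below = ⊥-elim (below m ≤-refl Pm)

∸-gap-< : ∀ {i j p} → i < j → j < p → suc (j ∸ suc i) < p
∸-gap-< i<j j<p = ≤-trans (s≤s (∸-monoʳ-< (s≤s z≤n) i<j)) j<p

module CycleDecomposition {n : ℕ} (D : Digraph n) (σ : Fin n → Fin n)
  (arc : ∀ v → Arc D v (σ v)) (σ-injective : ∀ x y → σ x ≡ σ y → x ≡ y) where

  open import Data.List.Membership.DecPropositional (_≟_ {n}) using (_∈?_)

  σ^ : ℕ → Fin n → Fin n
  σ^ k v = iterate σ v k

  orbit : ℕ → Fin n → List (Fin n)
  orbit k v = List.iterate σ v k

  σ^-σ : ∀ k v → σ^ k (σ v) ≡ σ (σ^ k v)
  σ^-σ zero    v = refl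
  σ^-σ (suc k) v = σ^-σ k (σ v)

  σ^-+ : ∀ i j v → σ^ (i + j) v ≡ σ^ j (σ^ i v)
  σ^-+ zero    j v = refl
  σ^-+ (suc i) j v = σ^-+ i j (σ v)

  σ^-injective : ∀ i {x y} → σ^ i x ≡ σ^ i y → x ≡ y
  σ^-injective zero    eq = eq
  σ^-injective (suc i) eq = σ-injective _ _ (σ^-injective i eq)

  ∈-orbit⁻ : ∀ k {v x} → x ∈ orbit k v → ∃ λ i → i < k × x ≡ σ^ i v
  ∈-orbit⁻ (suc k) (here x≡v) = 0 , s≤s z≤n , x≡v
  ∈-orbit⁻ (suc k) (there x∈) with i , i<k , x≡ ← ∈-orbit⁻ k x∈ = suc i , s≤s i<k , x≡

  ∈-orbit⁺ : ∀ {k} v {i} → i < k → σ^ i v ∈ orbit k v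
  ∈-orbit⁺ v {zero}  (s≤s _)   = here refl
  ∈-orbit⁺ v {suc i} (s≤s i<k) = there (∈-orbit⁺ (σ v) i<k)

  orbit-linked : ∀ k v → Linked (Arc D) (orbit k v ++ [ σ^ k v ])
  orbit-linked zero          v = [-]
  orbit-linked (suc zero)    v = arc v ∷ [-]
  orbit-linked (suc (suc k)) v = arc v ∷ orbit-linked (suc k) (σ v)

  orbit-unique : ∀ k v → (∀ i j → i < k → j < k → σ^ i v ≡ σ^ j v → i ≡ j) → Unique (orbit k v)
  orbit-unique zero    v _        = []
  orbit-unique (suc k) v distinct = All.tabulate v≢later ∷ orbit-unique k (σ v) distinct-later
    where
    v≢later : ∀ {x} → x ∈ orbit k (σ v) → v ≢ x
    v≢later x∈ v≡x with i , i<k , x≡ ← ∈-orbit⁻ k x∈ with () ← distinct 0 (suc i) (s≤s z≤n) (s≤s i<k) (trans v≡x x≡)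
    distinct-later : ∀ i j → i < k → j < k → σ^ i (σ v) ≡ σ^ j (σ v) → i ≡ j
    distinct-later i j i<k j<k eq = suc-injective (distinct (suc i) (suc j) (s≤s i<k) (s≤s j<k) eq)

  σ-no-fixpoint : ∀ v → σ v ≢ v
  σ-no-fixpoint v σv≡v with () ← trans (sym (subst (Arc D v) σv≡v (arc v))) (Digraph.loopless D v)

  Returns : Fin n → ℕ → Set
  Returns v k = σ^ (suc k) v ≡ v

  returns-between : ∀ v {i j} → i < j → σ^ i v ≡ σ^ j v → Returns v (j ∸ suc i)
  returns-between v {i} {j} i<j σⁱv≡σʲv = σ^-injective i (begin
    σ^ i (σ^ (suc d) v)  ≡⟨ σ^-+ (suc d) i v ⟨
    σ^ (suc d + i) v     ≡⟨ cong (λ m → σ^ m v) (trans (sym (+-suc d i)) (m∸n+n≡m i<j)) ⟩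
    σ^ j v               ≡⟨ σⁱv≡σʲv ⟨
    σ^ i v               ∎)
    where
    open ≡-Reasoning
    d = j ∸ suc i

  returns : ∀ v → ∃ (Returns v)
  returns v with i , j , i<j , σⁱv≡σʲv ← pigeonhole (n<1+n n) (λ i → σ^ (toℕ i) v) =
    toℕ j ∸ suc (toℕ i) , returns-between v i<j σⁱv≡σʲv

  module _ (v : Fin n) where

    -- Opaque: unfolding it would run the pigeonhole search during type checking.
    opaque
      first-return : ∃ λ k → Returns v k × (∀ j → j < k → ¬ Returns v j)
      first-return = least-witness {P = Returns v} (λ k → σ^ (suc k) v ≟ v) (returns v)

    period : ℕ
    period = suc (proj₁ first-return)

    σ^period : σ^ period v ≡ v
    σ^period = proj₁ (proj₂ first-return)

    no-earlier-return : ∀ j → suc j < period → σ^ (suc j) v ≢ v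
    no-earlier-return j = proj₂ (proj₂ first-return) j ∘ s≤s⁻¹

    σ^-injective-below-period : ∀ i j → i < period → j < period → σ^ i v ≡ σ^ j v → i ≡ j
    σ^-injective-below-period i j i<p j<p eq with <-cmp i j
    ... | tri< i<j _ _ = ⊥-elim (no-earlier-return _ (∸-gap-< i<j j<p) (returns-between v i<j eq))
    ... | tri≈ _ i≡j _ = i≡j
    ... | tri> _ _ j<i = ⊥-elim (no-earlier-return _ (∸-gap-< j<i i<p) (returns-between v j<i (sym eq)))

    period≥2 : 2 ≤ period
    period≥2 = nontrivial first-return
      where
      nontrivial : (r : ∃ λ k → Returns v k × (∀ j → j < k → ¬ Returns v j)) → 2 ≤ suc (proj₁ r)
      nontrivial (zero  , σv≡v , _) = ⊥-elim (σ-no-fixpoint v σv≡v)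
      nontrivial (suc _ , _    , _) = s≤s (s≤s z≤n)

    cycle-of : Cycle D
    cycle-of = record
      { verts    = orbit period v
      ; len≥2    = subst (2 ≤_) (sym (length-iterate σ v period)) period≥2
      ; distinct = orbit-unique period v σ^-injective-below-period
      ; closed   = subst (λ z → Linked (Arc D) (orbit period v ++ [ z ])) σ^period (orbit-linked period v)
      }

    orbit-preimage : ∀ {w} → σ w ∈ orbit period v → w ∈ orbit period v
    orbit-preimage {w} σw∈ with ∈-orbit⁻ period σw∈
    ... | zero  , _ , σw≡v = subst (_∈ orbit period v)
            (σ-injective _ _ (trans (sym (σ^-σ (proj₁ first-return) v)) (trans σ^period (sym σw≡v))))
            (∈-orbit⁺ v ≤-refl)
    ... | suc i , s≤s i<k , σw≡ = subst (_∈ orbit period v)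
            (σ-injective _ _ (trans (sym (σ^-σ i v)) (sym σw≡)))
            (∈-orbit⁺ v (m<n⇒m<1+n i<k))

  Closed : List (Fin n) → Set
  Closed R = ∀ w → w ∈ R → σ w ∈ R

  record Covering (R : List (Fin n)) : Set where
    field
      cycles   : List (Cycle D)
      disjoint : Unique (concatMap Cycle.verts cycles)
      sound    : ∀ x → x ∈ concatMap Cycle.verts cycles → x ∈ R
      complete : ∀ x → x ∈ R → x ∈ concatMap Cycle.verts cycles

  covering : ∀ fuel R → length R ≤ fuel → Closed R → Covering R
  covering _          []       _       _      = record { cycles = [] ; disjoint = [] ; sound = λ _ () ; complete = λ _ () }
  covering (suc fuel) (v ∷ R) (s≤s R≤) closed = record
    { cycles   = cycle-of v ∷ cycles rest
    ; disjoint = ++⁺ (Cycle.distinct (cycle-of v)) (disjoint rest)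
                     λ (x∈O , x∈rest) → proj₂ (∈-filter⁻ outside? {xs = R} (sound rest _ x∈rest)) x∈O
    ; sound    = λ x x∈ → [ orbit⊆ x , there ∘ proj₁ ∘ ∈-filter⁻ outside? {xs = R} ∘ sound rest x ]′ (∈-++⁻ O x∈)
    ; complete = complete′
    }
    where
    open Covering
    O : List (Fin n)
    O = orbit (period v) v
    outside? : ∀ w → Dec (w ∉ O)
    outside? w = ¬? (w ∈? O)
    σ^∈ : ∀ i → σ^ i v ∈ v ∷ R
    σ^∈ zero    = here refl
    σ^∈ (suc i) = subst (_∈ v ∷ R) (sym (σ^-σ i v)) (closed _ (σ^∈ i))
    orbit⊆ : ∀ x → x ∈ O → x ∈ v ∷ R
    orbit⊆ x x∈O with i , _ , x≡ ← ∈-orbit⁻ (period v) x∈O = subst (_∈ v ∷ R) (sym x≡) (σ^∈ i)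
    closed′ : Closed (filter outside? R)
    closed′ w w∈ with w∈R , w∉O ← ∈-filter⁻ outside? {xs = R} w∈ with closed w (there w∈R)
    ... | here σw≡v   = ⊥-elim (w∉O (orbit-preimage v (subst (_∈ O) (sym σw≡v) (here refl))))
    ... | there σw∈R  = ∈-filter⁺ outside? σw∈R (w∉O ∘ orbit-preimage v)
    rest : Covering (filter outside? R)
    rest = covering fuel (filter outside? R) (≤-trans (length-filter outside? R) R≤) closed′
    complete′ : ∀ x → x ∈ v ∷ R → x ∈ O ++ concatMap Cycle.verts (cycles rest)
    complete′ x (here refl) = ∈-++⁺ˡ (∈-orbit⁺ {period v} v (s≤s z≤n))
    complete′ x (there x∈R) with x ∈? O
    ... | yes x∈O = ∈-++⁺ˡ x∈O
    ... | no  x∉O = ∈-++⁺ʳ O (complete rest x (∈-filter⁺ outside? x∈R x∉O))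

  cycle-factor : CycleFactor D
  cycle-factor = cycles all , ∼bag⇒↭ (unique∧set⇒bag (disjoint all) (allFin⁺ n)
    (mk⇔ (sound all _) (λ _ → complete all _ (∈-allFin _))))
    where
    open Covering
    all : Covering (allFin n)
    all = covering _ (allFin n) ≤-refl (λ w _ → ∈-allFin (σ w))

degree : ∀ {n} → (Fin n → Fin n → Bool) → Fin n → ℕ
degree E x = card (E x) + card (λ u → E u x)

half-bound : ∀ a t → 3 * a ≤ (t + a) + (t + a) → a ≤ t + t
half-bound a t 3a≤ = +-cancelʳ-≤ (2 * a) a (t + t) (begin
  3 * a                    ≤⟨ 3a≤ ⟩
  (t + a) + (t + a)        ≡⟨ rearrange t a ⟩
  (t + t) + 2 * a          ∎)
  where
  open ℕ.≤-Reasoning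
  rearrange : ∀ t a → (t + a) + (t + a) ≡ (t + t) + 2 * a
  rearrange = solve 2 (λ t a → (t :+ a) :+ (t :+ a) := (t :+ t) :+ con 2 :* a) refl

-- Two vertices of X share an out-neighbour by pigeonhole, and each has degree at most |Y| + |Z|.
crowding : ∀ {n a} (E : Fin n → Fin n → Bool) {X Y Z : Fin n → Bool} →
  (∀ x₁ x₂ → x₁ ≢ x₂ → (∃ λ y → E x₁ y ≡ true × E x₂ y ≡ true) → 3 * a ≤ degree E x₁ + degree E x₂) →
  (∀ x → ∃ λ y → E x y ≡ true) →
  (∀ {x y} → X x ≡ true → E x y ≡ true → Y y ≡ true) →
  (∀ {x u} → X x ≡ true → E u x ≡ true → Z u ≡ true) →
  card Z ≡ a → card Y < card X → a ≤ card Y + card Y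
crowding {a = a} E {X} {Y} {Z} dense succ out⊆Y in⊆Z |Z| Y<X
  with x₁ , x₂ , x₁≢x₂ , Xx₁ , Xx₂ , same ← collision (proj₁ ∘ succ) Y<X (λ x Xx → out⊆Y Xx (proj₂ (succ x))) =
  half-bound a (card Y) (begin
    3 * a                                        ≤⟨ dense x₁ x₂ x₁≢x₂ (_ , proj₂ (succ x₁) , common) ⟩
    degree E x₁ + degree E x₂                    ≤⟨ +-mono-≤ (bounded Xx₁) (bounded Xx₂) ⟩
    (card Y + card Z) + (card Y + card Z)        ≡⟨ cong (λ z → (card Y + z) + (card Y + z)) |Z| ⟩
    (card Y + a) + (card Y + a)                  ∎)
  where
  open ℕ.≤-Reasoning
  common : E x₂ (proj₁ (succ x₁)) ≡ true
  common = subst (λ y → E x₂ y ≡ true) (sym same) (proj₂ (succ x₂))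
  bounded : ∀ {x} → X x ≡ true → degree E x ≤ card Y + card Z
  bounded Xx = +-mono-≤ (card-mono λ _ → out⊆Y Xx) (card-mono λ _ → in⊆Z Xx)

complement-< : ∀ {s s′ t t′} → s′ + s ≡ t′ + t → t < s → s′ < t′
complement-< {s} {s′} {t} {t′} eq t<s = +-cancelʳ-≤ t (suc s′) t′ (begin
  suc s′ + t   ≡⟨ +-suc s′ t ⟨
  s′ + suc t   ≤⟨ +-monoʳ-≤ s′ t<s ⟩
  s′ + s       ≡⟨ eq ⟩
  t′ + t       ∎)
  where open ℕ.≤-Reasoning

halves-too-small : ∀ {a s s′ t} → a ≤ t + t → a ≤ s′ + s′ → s′ + s ≡ a → t < s → ⊥
halves-too-small {a} {s} {s′} {t} a≤2t a≤2s′ s′+s≡a t<s = <-irrefl refl (begin-strict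
  a + a                    ≤⟨ +-mono-≤ a≤2t a≤2s′ ⟩
  (t + t) + (s′ + s′)      <⟨ +-monoˡ-< (s′ + s′) (+-mono-< t<s t<s) ⟩
  (s + s) + (s′ + s′)      ≡⟨ rearrange s s′ ⟩
  (s′ + s) + (s′ + s)      ≡⟨ cong (λ m → m + m) s′+s≡a ⟩
  a + a                    ∎)
  where
  open ℕ.≤-Reasoning
  rearrange : ∀ s s′ → (s + s) + (s′ + s′) ≡ (s′ + s) + (s′ + s)
  rearrange = solve 2 (λ s s′ → (s :+ s) :+ (s′ :+ s′) := (s′ :+ s) :+ (s′ :+ s)) refl

module _ {n : ℕ} (D : Digraph n) {a : ℕ}
  (dense : ∀ x y → x ≢ y → CommonInOrOutNeighbour D x y → 3 * a ≤ deg D x + deg D y)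
  (has-out : ∀ x → ∃ λ y → Arc D x y) (has-in : ∀ y → ∃ λ x → Arc D x y) where

  open Digraph D
  open Hall adj

  dense-out : ∀ x₁ x₂ → x₁ ≢ x₂ → (∃ λ y → adj x₁ y ≡ true × adj x₂ y ≡ true) →
    3 * a ≤ degree adj x₁ + degree adj x₂
  dense-out x₁ x₂ x₁≢x₂ common =
    subst₂ (λ d₁ d₂ → 3 * a ≤ d₁ + d₂) (deg≡ x₁) (deg≡ x₂) (dense x₁ x₂ x₁≢x₂ (inj₂ common))
    where
    deg≡ : ∀ x → deg D x ≡ degree adj x
    deg≡ x = cong₂ _+_ (sym card≡sum-allFin) (sym card≡sum-allFin)

  dense-in : ∀ y₁ y₂ → y₁ ≢ y₂ → (∃ λ x → adj x y₁ ≡ true × adj x y₂ ≡ true) →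
    3 * a ≤ degree (flip adj) y₁ + degree (flip adj) y₂
  dense-in y₁ y₂ y₁≢y₂ common =
    subst₂ (λ d₁ d₂ → 3 * a ≤ d₁ + d₂) (deg≡ y₁) (deg≡ y₂) (dense y₁ y₂ y₁≢y₂ (inj₁ common))
    where
    deg≡ : ∀ y → deg D y ≡ degree (flip adj) y
    deg≡ y = trans (+-comm (outdeg D y) (indeg D y)) (cong₂ _+_ (sym card≡sum-allFin) (sym card≡sum-allFin))

  hall-condition : (A : Fin n → Bool) → card A ≡ a → card (not ∘ A) ≡ a →
    (∀ {u v} → Arc D u v → A v ≡ not (A u)) → HallCondition A (not ∘ A)
  hall-condition A |A| |B| alternates S S⊆A with card S ≤? card (Γ (not ∘ A) S)
  ... | yes S≤ΓS = S≤ΓS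
  ... | no  S≰ΓS = ⊥-elim (halves-too-small a≤2T a≤2S′ |S′|+|S| T<S)
    where
    B = not ∘ A
    T = Γ B S
    S′ = A ─ S
    T′ = B ─ T
    T<S : card T < card S
    T<S = ≰⇒> S≰ΓS
    |S′|+|S| : card S′ + card S ≡ a
    |S′|+|S| = trans (sym (card-split S⊆A)) |A|
    |T′|+|T| : card T′ + card T ≡ a
    |T′|+|T| = trans (sym (card-split λ y → proj₁ ∘ Γ⁻)) |B|
    out-neighbour-of-S : ∀ {x y} → S x ≡ true → Arc D x y → T y ≡ true
    out-neighbour-of-S {x} Sx e = Γ⁺ (cong not (trans (alternates e) (cong not (S⊆A x Sx)))) Sx e
    in-neighbour-of-T′ : ∀ {y u} → T′ y ≡ true → Arc D u y → S′ u ≡ true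
    in-neighbour-of-T′ {y} {u} T′y e with By , T′y′ ← ∧-true⁻ T′y with S u in Su
    ... | true  with () ← trans (sym T′y′) (cong not (Γ⁺ By Su e))
    ... | false = ∧-true⁺ (trans (sym (trans (cong not (alternates e)) (not-involutive (A u)))) By) refl
    a≤2T : a ≤ card T + card T
    a≤2T = crowding adj dense-out has-out out-neighbour-of-S
      (λ {x} Sx e → trans (sym (alternates e)) (S⊆A x Sx)) |B| T<S
    a≤2S′ : a ≤ card S′ + card S′
    a≤2S′ = crowding (flip adj) dense-in has-in in-neighbour-of-T′
      (λ T′y e → trans (alternates e) (proj₁ (∧-true⁻ T′y))) |A|
      (complement-< (trans |S′|+|S| (sym |T′|+|T|)) T<S)

  perfect-matching : (A : Fin n → Bool) → card A ≡ a → card (not ∘ A) ≡ a →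
    (∀ {u v} → Arc D u v → A v ≡ not (A u)) → Matching (λ _ → true) (λ _ → true)
  perfect-matching A |A| |B| alternates =
    Matching-glue A A→B B→A (λ _ _ → refl) (λ _ _ → refl)
      λ v Bv Av → true≢false (trans (sym Av) (not-injective Bv))
    where
    A→B : Matching A (not ∘ A)
    A→B = hall-theorem _ ≤-refl (hall-condition A |A| |B| alternates)
    B→A : Matching (not ∘ A) A
    B→A = Matching-⊆ (λ _ → id) (λ v → trans (sym (not-involutive (A v))))
      (hall-theorem _ ≤-refl (hall-condition (not ∘ A) |B| (trans (card-cong (not-involutive ∘ A)) |A|)
                                             (cong not ∘ alternates)))

Star-out : ∀ {a r} {A : Set a} {R : A → A → Set r} {u v} → Star R u v → u ≢ v → ∃ (R u)
Star-out ε       u≢u = ⊥-elim (u≢u refl)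
Star-out (r ◅ _) _   = _ , r

Star-in : ∀ {a r} {A : Set a} {R : A → A → Set r} {u v} → Star R u v → u ≢ v → ∃ λ w → R w v
Star-in walk u≢v = Star-out (reverse id walk) (u≢v ∘ sym)

another-vertex : ∀ {a} {A : Set a} (s : A → Bool) → (∃ λ y → s y ≡ true) → (∃ λ y → not (s y) ≡ true) →
  ∀ x → ∃ λ y → x ≢ y
another-vertex s (y₁ , sy₁) (y₀ , ¬sy₀) x with s x in sx
... | true  = y₀ , λ { refl → true≢false (trans (sym sx) (not-injective ¬sy₀)) }
... | false = y₁ , λ { refl → true≢false (trans (sym sy₁) sx) }

lemma3p1 : (a n : ℕ) → 2 ≤ a → (D : Digraph n) →
    StronglyConnected D → BalancedBipartite D a →
    (∀ x y → x ≢ y → CommonInOrOutNeighbour D x y → 3 * a ≤ deg D x + deg D y) →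
    CycleFactor D
lemma3p1 a n 2≤a D strong (side , |A|≡a , |B|≡a , bipartite) dense =
  CycleDecomposition.cycle-factor D (match M) (λ v → along M v refl) (λ x y → injective M x y refl refl)
  where
  open Hall (Digraph.adj D)
  open Matching
  |A| : card side ≡ a
  |A| = trans (sym (length-filter-true side)) |A|≡a
  |B| : card (not ∘ side) ≡ a
  |B| = trans (sym (length-filter-false side)) |B|≡a
  vertex-in : ∀ {P : Fin n → Bool} → card P ≡ a → ∃ λ v → P v ≡ true
  vertex-in |P| = 1≤card⇒∈ (subst (1 ≤_) (sym |P|) (≤-trans (s≤s z≤n) 2≤a))
  another : ∀ x → ∃ λ y → x ≢ y
  another = another-vertex side (vertex-in |A|) (vertex-in |B|)
  M : Matching (λ _ → true) (λ _ → true)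
  M = perfect-matching D dense
    (λ x → Star-out (strong x (proj₁ (another x))) (proj₂ (another x)))
    (λ y → Star-in (strong (proj₁ (another y)) y) (proj₂ (another y) ∘ sym))
    side |A| |B| (λ {u} {v} e → ¬-not (bipartite u v e ∘ sym))
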